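{- For every integer $n\geq 0$, the number of alternating permutations of length $n$ that avoid the pattern $1\mbox{ - }3\mbox{ - }2$ equals $C_{\lfloor n/2\rfloor}$. Moreover, for every $n\geq 3$: (1) the number of up-down permutations of length $n$ avoiding $1\mbox{ - }3\mbox{ - }2$ is $C_{(n-1)/2}$; (2) the number of up-up permutations of length $n$ avoiding $1\mbox{ - }3\mbox{ - }2$ is $C_{n/2}$; (3) the number of down-up permutations of length $n$ avoiding $1\mbox{ - }3\mbox{ - }2$ is $C_{(n+1)/2}$; (4) the number of down-down permutations of length $n$ avoiding $1\mbox{ - }3\mbox{ - }2$ is $C_{n/2}$. Here $C_m=\frac{1}{m+1}\binom{2m}{m}$ is the $m$th Catalan number, and $C_m$ is taken to be $0$ whenever $m$ is not an integer.
   Context: A permutation of length $n$ is a word $\pi=\pi_1\pi_2\cdots\pi_n$ in which each of $1,\dots,n$ appears exactly once (for $n=0$ it is the empty word). The classical pattern $1\mbox{ - }3\mbox{ - }2$ occurs in $\pi$ if there are indices $i<j<l$ with $\pi_i<\pi_l<\pi_j$; $\pi$ avoids $1\mbox{ - }3\mbox{ - }2$ if there is no such occurrence. A permutation $\pi$ of length $n$ is alternating if $\pi_{2j-1}<\pi_{2j}$ and $\pi_{2j}>\pi_{2j+1}$ whenever these indices lie in $\{1,\dots,n\}$ (so $\pi_1<\pi_2>\pi_3<\pi_4>\cdots$); the permutations of length $0$ and $1$ are alternating. For $n\geq 2$: an up-down permutation is an alternating permutation of odd length (it starts with a rise and ends with a descent); an up-up permutation is an alternating permutation of even length (starts and ends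 with a rise); a down-up permutation is one with $\pi_1>\pi_2<\pi_3>\pi_4<\cdots$ of odd length (starts with a descent, ends with a rise); a down-down permutation is one with $\pi_1>\pi_2<\pi_3>\cdots$ of even length (starts and ends with a descent). For $n=0,1$ there are no up-down, up-up, down-up or down-down permutations. -}

module Defs where

open import Data.Nat using (ℕ; zero; suc; _+_; _*_; _/_; _<_; _<ᵇ_)
open import Data.Nat.Combinatorics using (_C_)
open import Data.Fin using (Fin; toℕ) renaming (zero to fzero; suc to fsuc)
open import Data.Vec using (Vec; lookup)
open import Data.Bool using (Bool; true; false; _∧_; _∨_; not; if_then_else_)
open import Data.Product using (Σ; _×_)
open import Relation.Binary.PropositionalEquality using (_≡_)
open import Function.Bundles using (_↔_)

-- Catalan number C_m = (1/(m+1)) * binom(2m, m)  (exact division in ℕ).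
catalan : ℕ → ℕ
catalan m = ((2 * m) C m) / suc m

-- A word of length n over {0,…,n-1}; positions and values are 0-based
-- (value v here stands for v+1 in the paper).
Word : ℕ → Set
Word n = Vec (Fin n) n

allᵇ : (n : ℕ) → (Fin n → Bool) → Bool
allᵇ zero    p = true
allᵇ (suc n) p = p fzero ∧ allᵇ n (λ i → p (fsuc i))

_<ᶠ_ : ∀ {n} → Fin n → Fin n → Bool
i <ᶠ j = toℕ i <ᵇ toℕ j

_≡ᶠ_ : ∀ {n} → Fin n → Fin n → Bool
i ≡ᶠ j = not (i <ᶠ j) ∧ not (j <ᶠ i)

-- π is a permutation: each value occurs exactly once (for a length-n word
-- over n letters this is injectivity of i ↦ π_i).
isPerm : ∀ {n} → Word n → Bool
isPerm {n} π = allᵇ n λ i → allᵇ n λ j →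
  not (i <ᶠ j) ∨ not (lookup π i ≡ᶠ lookup π j)

avoids132 : ∀ {n} → Word n → Bool
avoids132 {n} π = allᵇ n λ i → allᵇ n λ j → allᵇ n λ l →
  not ((i <ᶠ j) ∧ (j <ᶠ l) ∧ (lookup π i <ᶠ lookup π l) ∧ (lookup π l <ᶠ lookup π j))

even : ℕ → Bool
even zero = true
even (suc n) = not (even n)

-- Starting-with-rise alternation: for 0-based k, π_k < π_{k+1} if k even
-- and π_k > π_{k+1} if k odd  (i.e. π_1<π_2>π_3<… in 1-based notation).
adjOK : ∀ {n} → Bool → Word n → Fin n → Fin n → Bool
adjOK startUp π i j =
  not (suc (toℕ i) ≡ᵇ' toℕ j) ∨
  (if (even (toℕ i) ≡ᵇB startUp)
     then (lookup π i <ᶠ lookup π j)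
     else (lookup π j <ᶠ lookup π i))
  where
  _≡ᵇ'_ : ℕ → ℕ → Bool
  a ≡ᵇ' b = not (a <ᵇ b) ∧ not (b <ᵇ a)
  _≡ᵇB_ : Bool → Bool → Bool
  true ≡ᵇB b = b
  false ≡ᵇB b = not b

alternatesFrom : ∀ {n} → Bool → Word n → Bool
alternatesFrom {n} startUp π = allᵇ n λ i → allᵇ n λ j → adjOK startUp π i j

alternating : ∀ {n} → Word n → Bool
alternating = alternatesFrom true

downAlternating : ∀ {n} → Word n → Bool
downAlternating = alternatesFrom false

-- the four classes (the theorem only uses them for n ≥ 3, where n ≥ 2 holds)
upDown upUp downUp downDown : ∀ {n} → Word n → Bool
upDown   {n} π = alternating π ∧ not (even n)
upUp     {n} π = alternating π ∧ even n
downUp   {n} π = downAlternating π ∧ not (even n)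
downDown {n} π = downAlternating π ∧ even n

Avoiders : (n : ℕ) → (Word n → Bool) → Set
Avoiders n P = Σ (Word n) λ π → (isPerm π ∧ avoids132 π ∧ P π) ≡ true

HasCount : Set → ℕ → Set
HasCount A k = A ↔ Fin k

catalanHalf : ℕ → ℕ
catalanHalf m = if even m then catalan (m / 2) else 0

module Submission where

-- Every entry of a 132-avoiding permutation that precedes its maximum m exceeds every entry
-- that follows it, so the permutation is (α + |β|) m β for 132-avoiding permutations α and β
-- of the values below, and this decomposition is a bijection. In an alternating permutation
-- the maximum sits at a peak: this fixes the parity of |α| and forces β to start with a rise.
-- Hence the numbers U(n) and D(n) of 132-avoiding alternating permutations of length n that
-- start with a rise, resp. a descent, satisfy U(m+1) = Σ U(a) U(b) and D(m+1) = Σ D(a) U(b)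
-- over a + b = m with a odd, resp. even (plus the term a = b = 0 of U(1)). Splitting these
-- sums by parity turns them into Segner's recurrence, so U(n) = C_⌊n/2⌋ and D(n) = C_⌈n/2⌉.
-- The Catalan numbers enter as the diagonal ballot numbers, for which Segner's recurrence is
-- the decomposition of a lattice path at its last point on the diagonal.

open import Defs
import Algebra.Properties.CommutativeSemigroup
import Algebra.Solver.CommutativeMonoid
open import Axiom.UniquenessOfIdentityProofs.WithK using (uip)
open import Data.Bool using (Bool; true; false; _∧_; _∨_; not; if_then_else_)
open import Data.Bool.ListAction using (all)
open import Data.Bool.Properties
  using (T-≡; ∧-assoc; ∧-comm; ∧-identityʳ; ∧-zeroʳ; ∧-idem; not-involutive; ∧-commutativeMonoid)
open import Data.Fin using (Fin; toℕ; fromℕ<) renaming (zero to fzero; suc to fsuc)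
open import Data.Fin.Properties using (toℕ-fromℕ<; toℕ-injective; toℕ<n; injective⇒≤; +↔⊎; *↔×)
open import Data.List using (List; []; _∷_; _++_; length)
import Data.List as List
open import Data.List.Membership.Propositional using (_∈_)
open import Data.List.Membership.Propositional.Properties
  using (∈-lookup; ∈-++⁺ʳ; ∈-++⁺ˡ; ∈-++⁻; ∈-map⁻)
open import Data.List.Properties using (length-++; length-map)
open import Data.List.Relation.Unary.Any using (here; there)
open import Data.Nat
open import Data.Nat.Combinatorics
open import Data.Nat.Combinatorics.Specification using (nCk≡n!/k![n-k]!)
open import Data.Nat.DivMod using (m/n*n≡m; m*n/n≡m; m/n≡1+[m∸n]/n)
open import Data.Nat.Induction using (<-rec)
open import Data.Nat.Properties
open import Data.List.Membership.DecPropositional _≟_ using (_∈?_)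
open import Data.Product using (Σ; _×_; _,_; proj₁; proj₂)
open import Data.Product.Function.NonDependent.Propositional using (_×-↔_)
open import Data.Sum using (_⊎_; inj₁; inj₂)
open import Data.Sum.Function.Propositional using (_⊎-↔_)
open import Data.Vec using (Vec; []; _∷_; lookup)
open import Function using (_∘_)
open import Function.Bundles using (Equivalence; _↔_; mk↔ₛ′)
open import Function.Properties.Inverse using (↔-trans; ↔-sym)
open import Relation.Binary.Definitions using (tri<; tri≈; tri>)
open import Relation.Binary.PropositionalEquality
open import Relation.Nullary using (contradiction)
open import Relation.Nullary.Decidable using (yes; no; does; dec-true; dec-false)
open ≡-Reasoning

module +-CS = Algebra.Properties.CommutativeSemigroup +-commutativeSemigroup
module *-CS = Algebra.Properties.CommutativeSemigroup *-commutativeSemigroup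
module ∧-CM = Algebra.Solver.CommutativeMonoid ∧-commutativeMonoid
open ∧-CM using (_⊕_; _⊜_)

-- Catalan numbers as diagonal ballot numbers

-- ballot u j = C(u+j, j) − C(u+j, j−1) for j ≤ u: the lattice paths with u east and
-- j north steps that never rise above the diagonal.
ballot : ℕ → ℕ → ℕ
ballot u       zero    = 1
ballot zero    (suc j) = 0
ballot (suc u) (suc j) = if does (j ≤? u) then ballot u (suc j) + ballot (suc u) j else 0

ballot-above-diagonal : ∀ {u j} → u < j → ballot u j ≡ 0
ballot-above-diagonal {zero}  {suc j} _         = refl
ballot-above-diagonal {suc u} {suc j} (s≤s u<j) rewrite dec-false (j ≤? u) (<⇒≱ u<j) = refl

ballot-suc : ∀ {u j} → j ≤ u → ballot (suc u) (suc j) ≡ ballot u (suc j) + ballot (suc u) j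
ballot-suc {u} {j} j≤u rewrite dec-true (j ≤? u) j≤u = refl

diagSum : ℕ → (ℕ → ℕ → ℕ) → ℕ
diagSum zero    g = g 0 0
diagSum (suc n) g = g 0 (suc n) + diagSum n (λ i k → g (suc i) k)

diagSum-cong : ∀ n {f g : ℕ → ℕ → ℕ} → (∀ i k → i + k ≡ n → f i k ≡ g i k) →
               diagSum n f ≡ diagSum n g
diagSum-cong zero    f≡g = f≡g 0 0 refl
diagSum-cong (suc n) f≡g =
  cong₂ _+_ (f≡g 0 (suc n) refl) (diagSum-cong n (λ i k e → f≡g (suc i) k (cong suc e)))

diagSum-zero : ∀ n (g : ℕ → ℕ → ℕ) → (∀ i k → i + k ≡ n → g i k ≡ 0) → diagSum n g ≡ 0
diagSum-zero zero    g g≡0 = g≡0 0 0 refl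
diagSum-zero (suc n) g g≡0 rewrite g≡0 0 (suc n) refl =
  diagSum-zero n _ (λ i k e → g≡0 (suc i) k (cong suc e))

diagSum-+ : ∀ n (f g : ℕ → ℕ → ℕ) →
            diagSum n (λ i k → f i k + g i k) ≡ diagSum n f + diagSum n g
diagSum-+ zero    f g = refl
diagSum-+ (suc n) f g
  rewrite diagSum-+ n (λ i k → f (suc i) k) (λ i k → g (suc i) k) =
  +-CS.interchange (f 0 (suc n)) (g 0 (suc n)) _ _

diagSum-sucʳ : ∀ n (g : ℕ → ℕ → ℕ) →
               diagSum (suc n) g ≡ diagSum n (λ i k → g i (suc k)) + g (suc n) 0
diagSum-sucʳ zero    g = refl
diagSum-sucʳ (suc n) g rewrite diagSum-sucʳ n (λ i k → g (suc i) k) =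
  sym (+-assoc (g 0 (suc (suc n))) _ _)

convolution convolution⁺ : ℕ → ℕ → ℕ
convolution  c j = diagSum j (λ i k → ballot i i * ballot (k + c) k)
convolution⁺ c j = diagSum j (λ i k → ballot i i * ballot (k + c) (suc k))

convolution-suc : ∀ c j →
  convolution c (suc j) ≡ convolution⁺ (suc c) j + ballot (suc j) (suc j) * 1
convolution-suc c j = begin
  convolution c (suc j)
    ≡⟨ diagSum-sucʳ j (λ i k → ballot i i * ballot (k + c) k) ⟩
  diagSum j (λ i k → ballot i i * ballot (suc (k + c)) (suc k)) + ballot (suc j) (suc j) * 1
    ≡⟨ cong (_+ _) (diagSum-cong j λ i k _ →
         cong (λ x → ballot i i * ballot x (suc k)) (sym (+-suc k c))) ⟩
  convolution⁺ (suc c) j + ballot (suc j) (suc j) * 1 ∎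

convolution⁺-pascal : ∀ c j → convolution⁺ (suc c) j ≡ convolution⁺ c j + convolution (suc c) j
convolution⁺-pascal c j = begin
  convolution⁺ (suc c) j
    ≡⟨ diagSum-cong j (λ i k _ → trans (cong (ballot i i *_) (pascal k)) (*-distribˡ-+ (ballot i i) _ _)) ⟩
  diagSum j (λ i k → ballot i i * ballot (k + c) (suc k) + ballot i i * ballot (k + suc c) k)
    ≡⟨ diagSum-+ j _ _ ⟩
  convolution⁺ c j + convolution (suc c) j ∎
  where
  pascal : ∀ k → ballot (k + suc c) (suc k) ≡ ballot (k + c) (suc k) + ballot (k + suc c) k
  pascal k rewrite +-suc k c = ballot-suc (m≤m+n k c)

convolution⁺-zero : ∀ j → convolution⁺ 0 j ≡ 0
convolution⁺-zero j = diagSum-zero j _ λ i k _ →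
  trans (cong (ballot i i *_) (ballot-above-diagonal (s≤s (≤-reflexive (+-identityʳ k)))))
        (*-zeroʳ (ballot i i))

convolution-step : ∀ j c →
  ballot (suc (j + c)) (suc j) ≡ convolution⁺ c j + ballot (suc j) (suc j) * 1 →
  ballot (suc (j + suc c)) j ≡ convolution (suc c) j →
  ballot (suc (suc (j + c))) (suc j) ≡ convolution c (suc j)
convolution-step j c diagonal below = begin
  ballot (suc (suc (j + c))) (suc j)
    ≡⟨ ballot-suc (m≤n⇒m≤1+n (m≤m+n j c)) ⟩
  ballot (suc (j + c)) (suc j) + ballot (suc (suc (j + c))) j
    ≡⟨ cong₂ _+_ diagonal (trans (cong (λ x → ballot (suc x) j) (sym (+-suc j c))) below) ⟩
  (convolution⁺ c j + ballot (suc j) (suc j) * 1) + convolution (suc c) j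
    ≡⟨ +-CS.xy∙z≈xz∙y (convolution⁺ c j) _ _ ⟩
  (convolution⁺ c j + convolution (suc c) j) + ballot (suc j) (suc j) * 1
    ≡⟨ cong (_+ _) (convolution⁺-pascal c j) ⟨
  convolution⁺ (suc c) j + ballot (suc j) (suc j) * 1
    ≡⟨ convolution-suc c j ⟨
  convolution c (suc j) ∎

-- Split a path at its last point on the diagonal.
ballot-convolution : ∀ j c → ballot (suc (j + c)) j ≡ convolution c j
ballot-convolution zero    c       = refl
ballot-convolution (suc j) zero    = convolution-step j 0 diagonal (ballot-convolution j 1)
  where
  diagonal : ballot (suc (j + 0)) (suc j) ≡ convolution⁺ 0 j + ballot (suc j) (suc j) * 1
  diagonal = begin
    ballot (suc (j + 0)) (suc j)   ≡⟨ cong (λ x → ballot (suc x) (suc j)) (+-identityʳ j) ⟩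
    ballot (suc j) (suc j)         ≡⟨ *-identityʳ _ ⟨
    ballot (suc j) (suc j) * 1     ≡⟨ cong (_+ ballot (suc j) (suc j) * 1) (convolution⁺-zero j) ⟨
    convolution⁺ 0 j + ballot (suc j) (suc j) * 1 ∎
ballot-convolution (suc j) (suc c) = convolution-step j (suc c)
  (trans (cong (λ x → ballot (suc x) (suc j)) (+-suc j c))
         (trans (ballot-convolution (suc j) c) (convolution-suc c j)))
  (ballot-convolution j (suc (suc c)))

ballot-segner : ∀ m → ballot (suc m) (suc m) ≡ diagSum m (λ i k → ballot i i * ballot k k)
ballot-segner m = begin
  ballot (suc m) (suc m)            ≡⟨ ballot-suc {m} ≤-refl ⟩
  ballot m (suc m) + ballot (suc m) m
    ≡⟨ cong₂ _+_ (ballot-above-diagonal {m} ≤-refl)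
                 (cong (λ x → ballot (suc x) m) (sym (+-identityʳ m))) ⟩
  ballot (suc (m + 0)) m            ≡⟨ ballot-convolution m 0 ⟩
  convolution 0 m
    ≡⟨ diagSum-cong m (λ i k _ → cong (λ x → ballot i i * ballot x k) (+-identityʳ k)) ⟩
  diagSum m (λ i k → ballot i i * ballot k k) ∎

_C⁻_ : ℕ → ℕ → ℕ
n C⁻ zero  = 0
n C⁻ suc j = n C j

suc[n]Ck≡nCk+nC⁻k : ∀ n k → suc n C k ≡ n C k + n C⁻ k
suc[n]Ck≡nCk+nC⁻k n zero    = refl
suc[n]Ck≡nCk+nC⁻k n (suc k) = trans (sym (nCk+nC[k+1]≡[n+1]C[k+1] n k)) (+-comm (n C k) (n C suc k))

ballot+C⁻≡C : ∀ u j → j ≤ u → ballot u j + (u + j) C⁻ j ≡ (u + j) C j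
ballot+C⁻≡C u       zero    _         = refl
ballot+C⁻≡C (suc u) (suc j) (s≤s j≤u) = begin
  ballot (suc u) (suc j) + suc N C j
    ≡⟨ cong₂ _+_ (ballot-suc j≤u) (suc[n]Ck≡nCk+nC⁻k N j) ⟩
  (ballot u (suc j) + ballot (suc u) j) + (N C j + N C⁻ j)
    ≡⟨ +-CS.interchange (ballot u (suc j)) _ _ _ ⟩
  (ballot u (suc j) + N C j) + (ballot (suc u) j + N C⁻ j)
    ≡⟨ cong₂ _+_ upper lower ⟩
  N C (suc j) + N C j
    ≡⟨ +-comm (N C (suc j)) (N C j) ⟩
  N C j + N C (suc j)
    ≡⟨ nCk+nC[k+1]≡[n+1]C[k+1] N j ⟩
  suc N C suc j ∎
  where
  N : ℕ
  N = u + suc j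
  lower : ballot (suc u) j + N C⁻ j ≡ N C j
  lower = subst (λ x → ballot (suc u) j + x C⁻ j ≡ x C j) (sym (+-suc u j))
                (ballot+C⁻≡C (suc u) j (m≤n⇒m≤1+n j≤u))
  upper : ballot u (suc j) + N C j ≡ N C (suc j)
  upper with m≤n⇒m<n∨m≡n j≤u
  ... | inj₁ j<u  = ballot+C⁻≡C u (suc j) j<u
  ... | inj₂ refl = begin
    ballot j (suc j) + N C j ≡⟨ cong (_+ N C j) (ballot-above-diagonal {j} ≤-refl) ⟩
    N C j                    ≡⟨ nCk≡nC[n∸k] (m≤m+n j (suc j)) ⟩
    N C (N ∸ j)              ≡⟨ cong (N C_) (m+n∸m≡n j (suc j)) ⟩
    N C (suc j)              ∎

suc[k]*nC[k+1]≡[n∸k]*nCk : ∀ {n k} → k < n → suc k * (n C suc k) ≡ (n ∸ k) * (n C k)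
suc[k]*nC[k+1]≡[n∸k]*nCk {n} {k} k<n = *-cancelʳ-≡ (suc k * (n C suc k)) _ d[k] {{k !* (n ∸ k) !≢0}} (begin
  suc k * (n C suc k) * d[k]    ≡⟨ *-assoc (suc k) (n C suc k) d[k] ⟩
  suc k * ((n C suc k) * d[k])  ≡⟨ *-CS.x∙yz≈y∙xz (suc k) (n C suc k) d[k] ⟩
  (n C suc k) * (suc k * d[k])  ≡⟨ cong ((n C suc k) *_) ([n-k]*d[k+1]≡[k+1]*d[k] k<n) ⟨
  (n C suc k) * ((n ∸ k) * d[k+1]) ≡⟨ *-CS.x∙yz≈y∙xz (n C suc k) (n ∸ k) d[k+1] ⟩
  (n ∸ k) * ((n C suc k) * d[k+1])
    ≡⟨ cong ((n ∸ k) *_) (trans (times-denominator k<n) (sym (times-denominator (<⇒≤ k<n)))) ⟩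
  (n ∸ k) * ((n C k) * d[k])    ≡⟨ *-assoc (n ∸ k) (n C k) d[k] ⟨
  (n ∸ k) * (n C k) * d[k]      ∎)
  where
  d[k] d[k+1] : ℕ
  d[k]   = k ! * (n ∸ k) !
  d[k+1] = suc k ! * (n ∸ suc k) !
  times-denominator : ∀ {i} → i ≤ n → (n C i) * (i ! * (n ∸ i) !) ≡ n !
  times-denominator {i} i≤n = trans (cong (_* (i ! * (n ∸ i) !)) (nCk≡n!/k![n-k]! i≤n))
                                    (m/n*n≡m {{i !* (n ∸ i) !≢0}} (k![n∸k]!∣n! i≤n))

catalan≡ballot : ∀ m → catalan m ≡ ballot m m
catalan≡ballot zero    = refl
catalan≡ballot (suc m) = begin
  ((2 * M) C M) / suc M      ≡⟨ cong (λ x → (x C M) / suc M) (cong (M +_) (+-identityʳ M)) ⟩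
  ((M + M) C M) / suc M      ≡⟨ cong (_/ suc M) times-suc ⟨
  (ballot M M * suc M) / suc M ≡⟨ m*n/n≡m (ballot M M) (suc M) ⟩
  ballot M M                 ∎
  where
  M N : ℕ
  M = suc m
  N = M + M
  absorption : M * (N C M) ≡ suc M * (N C m)
  absorption = trans (suc[k]*nC[k+1]≡[n∸k]*nCk (s≤s (m≤m+n m M)))
                     (cong (_* (N C m)) (trans (cong (_∸ m) (sym (+-suc m M))) (m+n∸m≡n m (suc M))))
  times-suc : ballot M M * suc M ≡ N C M
  times-suc = +-cancelʳ-≡ (M * (N C M)) _ _ (begin
    ballot M M * suc M + M * (N C M)      ≡⟨ cong (ballot M M * suc M +_) absorption ⟩
    ballot M M * suc M + suc M * (N C m)  ≡⟨ cong (_+ suc M * (N C m)) (*-comm (ballot M M) (suc M)) ⟩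
    suc M * ballot M M + suc M * (N C m)  ≡⟨ *-distribˡ-+ (suc M) (ballot M M) (N C m) ⟨
    suc M * (ballot M M + N C⁻ M)         ≡⟨ cong (suc M *_) (ballot+C⁻≡C M M ≤-refl) ⟩
    suc M * (N C M)                       ∎)

-- Sums over a + b = n, split by parity

double : ℕ → ℕ
double zero    = zero
double (suc k) = suc (suc (double k))

⌊double/2⌋ : ∀ k → ⌊ double k /2⌋ ≡ k
⌊double/2⌋ zero    = refl
⌊double/2⌋ (suc k) = cong suc (⌊double/2⌋ k)

⌊suc-double/2⌋ : ∀ k → ⌊ suc (double k) /2⌋ ≡ k
⌊suc-double/2⌋ zero    = refl
⌊suc-double/2⌋ (suc k) = cong suc (⌊suc-double/2⌋ k)

even-or-odd : ∀ m → (Σ ℕ λ k → m ≡ double k) ⊎ (Σ ℕ λ k → m ≡ suc (double k))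
even-or-odd zero = inj₁ (0 , refl)
even-or-odd (suc m) with even-or-odd m
... | inj₁ (k , refl) = inj₂ (k , refl)
... | inj₂ (k , refl) = inj₁ (suc k , refl)

-- the terms of diagSum (double k) g with odd indices
diagSumOdd : ℕ → (ℕ → ℕ → ℕ) → ℕ
diagSumOdd zero    g = 0
diagSumOdd (suc k) g = diagSum k (λ i j → g (suc (double i)) (suc (double j)))

diagSum-double : ∀ k g →
  diagSum (double k) g ≡ diagSum k (λ i j → g (double i) (double j)) + diagSumOdd k g
diagSum-suc-double : ∀ k g →
  diagSum (suc (double k)) g ≡ diagSum k (λ i j → g (double i) (suc (double j)))
                               + diagSum k (λ i j → g (suc (double i)) (double j))

diagSum-double zero    g = sym (+-identityʳ (g 0 0))
diagSum-double (suc k) g = trans (cong (g 0 (double (suc k)) +_) (diagSum-suc-double k (λ i j → g (suc i) j)))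
  (+-CS.x∙yz≈xz∙y (g 0 (double (suc k))) _ _)

diagSum-suc-double k g = begin
  g 0 (suc (double k)) + diagSum (double k) (λ i j → g (suc i) j)
    ≡⟨ cong (g 0 (suc (double k)) +_) (diagSum-double k (λ i j → g (suc i) j)) ⟩
  g 0 (suc (double k))
    + (diagSum k (λ i j → g (suc (double i)) (double j)) + diagSumOdd k (λ i j → g (suc i) j))
    ≡⟨ +-CS.x∙yz≈xz∙y (g 0 (suc (double k))) _ _ ⟩
  (g 0 (suc (double k)) + diagSumOdd k (λ i j → g (suc i) j))
    + diagSum k (λ i j → g (suc (double i)) (double j))
    ≡⟨ cong (_+ diagSum k (λ i j → g (suc (double i)) (double j))) (evenFirst k) ⟩
  diagSum k (λ i j → g (double i) (suc (double j))) + diagSum k (λ i j → g (suc (double i)) (double j)) ∎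
  where
  evenFirst : ∀ k → g 0 (suc (double k)) + diagSumOdd k (λ i j → g (suc i) j)
                  ≡ diagSum k (λ i j → g (double i) (suc (double j)))
  evenFirst zero    = +-identityʳ _
  evenFirst (suc k) = refl

-- Permutations as lists of values

∧-projˡ : ∀ {a b} → a ∧ b ≡ true → a ≡ true
∧-projˡ {true} _ = refl

∧-projʳ : ∀ {a b} → a ∧ b ≡ true → b ≡ true
∧-projʳ {true} b≡true = b≡true

∧-intro : ∀ {a b} → a ≡ true → b ≡ true → a ∧ b ≡ true
∧-intro refl refl = refl

true≢false : true ≢ false
true≢false ()

<ᵇ-true : ∀ {a b} → a < b → (a <ᵇ b) ≡ true
<ᵇ-true = Equivalence.to T-≡ ∘ <⇒<ᵇ

<ᵇ-true⁻¹ : ∀ {a b} → (a <ᵇ b) ≡ true → a < b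
<ᵇ-true⁻¹ {a} {b} a<ᵇb = <ᵇ⇒< a b (Equivalence.from T-≡ a<ᵇb)

<ᵇ-false : ∀ {a b} → b ≤ a → (a <ᵇ b) ≡ false
<ᵇ-false {a} {b} b≤a with a <ᵇ b in eq
... | false = refl
... | true  = contradiction (<ᵇ-true⁻¹ eq) (≤⇒≯ b≤a)

<ᵇ-false⁻¹ : ∀ {a b} → (a <ᵇ b) ≡ false → b ≤ a
<ᵇ-false⁻¹ a<ᵇb≡false = ≮⇒≥ (λ a<b → true≢false (trans (sym (<ᵇ-true a<b)) a<ᵇb≡false))

-- Defs' equality test on Fin, read on values
infix 4 _=ᵇ_
_=ᵇ_ : ℕ → ℕ → Bool
a =ᵇ b = not (a <ᵇ b) ∧ not (b <ᵇ a)

_≠_ : ℕ → ℕ → Bool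
a ≠ b = not (a =ᵇ b)

=ᵇ-refl : ∀ a → (a =ᵇ a) ≡ true
=ᵇ-refl a rewrite <ᵇ-false {a} ≤-refl = refl

=ᵇ-sym : ∀ a b → (a =ᵇ b) ≡ (b =ᵇ a)
=ᵇ-sym a b = ∧-comm (not (a <ᵇ b)) (not (b <ᵇ a))

<⇒=ᵇ-false : ∀ {a b} → a < b → (a =ᵇ b) ≡ false
<⇒=ᵇ-false a<b rewrite <ᵇ-true a<b = refl

>⇒=ᵇ-false : ∀ {a b} → b < a → (a =ᵇ b) ≡ false
>⇒=ᵇ-false {a} {b} b<a = trans (=ᵇ-sym a b) (<⇒=ᵇ-false b<a)

≢⇒=ᵇ-false : ∀ {a b} → a ≢ b → (a =ᵇ b) ≡ false
≢⇒=ᵇ-false {a} {b} a≢b with <-cmp a b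
... | tri< a<b _ _ = <⇒=ᵇ-false a<b
... | tri≈ _ a≡b _ = contradiction a≡b a≢b
... | tri> _ _ b<a = >⇒=ᵇ-false b<a

≠⇒≢ : ∀ {a b} → (a ≠ b) ≡ true → a ≢ b
≠⇒≢ {a} a≠b refl rewrite =ᵇ-refl a = true≢false (sym a≠b)

+-<ᵇ : ∀ b x y → (b + x <ᵇ b + y) ≡ (x <ᵇ y)
+-<ᵇ zero    x y = refl
+-<ᵇ (suc b) x y = +-<ᵇ b x y

module _ {A : Set} {p : A → Bool} where

  all-∈ : ∀ {xs} → all p xs ≡ true → ∀ {x} → x ∈ xs → p x ≡ true
  all-∈ {x ∷ xs} h (here refl) = ∧-projˡ h
  all-∈ {x ∷ xs} h (there x∈) = all-∈ (∧-projʳ {p x} h) x∈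

  ∈-all : ∀ xs → (∀ {x} → x ∈ xs → p x ≡ true) → all p xs ≡ true
  ∈-all []       _ = refl
  ∈-all (x ∷ xs) h = ∧-intro (h (here refl)) (∈-all xs (h ∘ there))

  all-++ : ∀ xs ys → all p (xs ++ ys) ≡ all p xs ∧ all p ys
  all-++ []       ys = refl
  all-++ (x ∷ xs) ys rewrite all-++ xs ys = sym (∧-assoc (p x) _ _)

  all-map : ∀ {B : Set} (f : B → A) xs → all p (List.map f xs) ≡ all (p ∘ f) xs
  all-map f []       = refl
  all-map f (x ∷ xs) = cong (p (f x) ∧_) (all-map f xs)

all-cong : ∀ {A : Set} {p q : A → Bool} xs → (∀ x → p x ≡ q x) → all p xs ≡ all q xs
all-cong []       p≡q = refl
all-cong (x ∷ xs) p≡q = cong₂ _∧_ (p≡q x) (all-cong xs p≡q)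

distinct : List ℕ → Bool
distinct []       = true
distinct (x ∷ xs) = all (x ≠_) xs ∧ distinct xs

no132From : ℕ → List ℕ → Bool
no132From x []       = true
no132From x (y ∷ ys) = all (λ z → not ((x <ᵇ z) ∧ (z <ᵇ y))) ys ∧ no132From x ys

avoids132ᴸ : List ℕ → Bool
avoids132ᴸ []       = true
avoids132ᴸ (x ∷ xs) = no132From x xs ∧ avoids132ᴸ xs

step : Bool → ℕ → ℕ → Bool
step up x y = if up then x <ᵇ y else y <ᵇ x

zigzag : Bool → List ℕ → Bool
zigzag up []           = true
zigzag up (x ∷ [])     = true
zigzag up (x ∷ y ∷ xs) = step up x y ∧ zigzag (not up) (y ∷ xs)

isWord : ℕ → ℕ → List ℕ → Bool
isWord k zero    []       = true
isWord k (suc m) (x ∷ xs) = (x <ᵇ k) ∧ isWord k m xs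
isWord k zero    (_ ∷ _)  = false
isWord k (suc m) []       = false

valid : Bool → List ℕ → Bool
valid up L = distinct L ∧ (avoids132ᴸ L ∧ zigzag up L)

allᵇ-cong : ∀ m {p q : Fin m → Bool} → (∀ i → p i ≡ q i) → allᵇ m p ≡ allᵇ m q
allᵇ-cong zero    p≡q = refl
allᵇ-cong (suc m) p≡q = cong₂ _∧_ (p≡q fzero) (allᵇ-cong m (p≡q ∘ fsuc))

allᵇ-true : ∀ m → allᵇ m (λ _ → true) ≡ true
allᵇ-true zero    = refl
allᵇ-true (suc m) = allᵇ-true m

-- The predicates of Defs for vectors whose length m need not be the alphabet size k, so that
-- induction on the vector goes through; adjacentOK is Defs.adjOK with its local equality test
-- on Bool unfolded.
module OnVectors {k : ℕ} where

  values : ∀ {m} → Vec (Fin k) m → List ℕ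
  values []       = []
  values (x ∷ xs) = toℕ x ∷ values xs

  isPermᵛ avoids132ᵛ : ∀ {m} → Vec (Fin k) m → Bool
  isPermᵛ {m} π = allᵇ m λ i → allᵇ m λ j →
    not (i <ᶠ j) ∨ not (lookup π i ≡ᶠ lookup π j)
  avoids132ᵛ {m} π = allᵇ m λ i → allᵇ m λ j → allᵇ m λ l →
    not ((i <ᶠ j) ∧ (j <ᶠ l) ∧ (lookup π i <ᶠ lookup π l) ∧ (lookup π l <ᶠ lookup π j))

  adjacentOK : ∀ {m} → Bool → Vec (Fin k) m → Fin m → Fin m → Bool
  adjacentOK up π i j =
    not (not (suc (toℕ i) <ᵇ toℕ j) ∧ not (toℕ j <ᵇ suc (toℕ i))) ∨
    (if (if even (toℕ i) then up else not up)
       then (lookup π i <ᶠ lookup π j) else (lookup π j <ᶠ lookup π i))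

  alternatesᵛ : ∀ {m} → Bool → Vec (Fin k) m → Bool
  alternatesᵛ {m} up π = allᵇ m λ i → allᵇ m λ j → adjacentOK up π i j

  allᵇ-lookup : ∀ {m} (q : ℕ → Bool) (xs : Vec (Fin k) m) →
                allᵇ m (λ j → q (toℕ (lookup xs j))) ≡ all q (values xs)
  allᵇ-lookup q []       = refl
  allᵇ-lookup q (x ∷ xs) = cong (q (toℕ x) ∧_) (allᵇ-lookup q xs)

  isPermᵛ≡distinct : ∀ {m} (xs : Vec (Fin k) m) → isPermᵛ xs ≡ distinct (values xs)
  isPermᵛ≡distinct []       = refl
  isPermᵛ≡distinct (x ∷ xs) =
    cong₂ _∧_ (allᵇ-lookup (λ y → not (toℕ x =ᵇ y)) xs) (isPermᵛ≡distinct xs)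

  no132Fromᵛ : ∀ {m} → Fin k → Vec (Fin k) m → Bool
  no132Fromᵛ {m} x π = allᵇ m λ j → allᵇ m λ l →
    not ((j <ᶠ l) ∧ (x <ᶠ lookup π l) ∧ (lookup π l <ᶠ lookup π j))

  no132Fromᵛ≡no132From : ∀ {m} x (xs : Vec (Fin k) m) → no132Fromᵛ x xs ≡ no132From (toℕ x) (values xs)
  no132Fromᵛ≡no132From x []       = refl
  no132Fromᵛ≡no132From x (y ∷ ys) =
    cong₂ _∧_ (allᵇ-lookup (λ z → not ((toℕ x <ᵇ z) ∧ (z <ᵇ toℕ y))) ys)
              (no132Fromᵛ≡no132From x ys)

  avoids132ᵛ-∷ : ∀ {m} x (xs : Vec (Fin k) m) →
                 avoids132ᵛ (x ∷ xs) ≡ no132Fromᵛ x xs ∧ avoids132ᵛ xs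
  avoids132ᵛ-∷ {m} x xs = cong₂ _∧_ (cong (_∧ no132Fromᵛ x xs) (allᵇ-true (suc m)))
    (allᵇ-cong m λ i → cong₂ _∧_ (allᵇ-true (suc m)) (allᵇ-cong m λ j →
      cong (λ b → not b ∧ allᵇ m (λ l → not ((i <ᶠ j) ∧ (j <ᶠ l)
                                             ∧ (lookup xs i <ᶠ lookup xs l) ∧ (lookup xs l <ᶠ lookup xs j))))
           (∧-zeroʳ (toℕ i <ᵇ toℕ j))))

  avoids132ᵛ≡avoids132ᴸ : ∀ {m} (xs : Vec (Fin k) m) → avoids132ᵛ xs ≡ avoids132ᴸ (values xs)
  avoids132ᵛ≡avoids132ᴸ []       = refl
  avoids132ᵛ≡avoids132ᴸ (x ∷ xs) = trans (avoids132ᵛ-∷ x xs)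
    (cong₂ _∧_ (no132Fromᵛ≡no132From x xs) (avoids132ᵛ≡avoids132ᴸ xs))

  if-not : ∀ e up → (if not e then up else not up) ≡ (if e then not up else not (not up))
  if-not true  up = refl
  if-not false up = sym (not-involutive up)

  alternatesᵛ-∷∷ : ∀ {m} up x y (xs : Vec (Fin k) m) →
    alternatesᵛ up (x ∷ y ∷ xs) ≡ step up (toℕ x) (toℕ y) ∧ alternatesᵛ (not up) (y ∷ xs)
  alternatesᵛ-∷∷ {m} up x y xs =
    cong₂ _∧_ (trans (cong (step up (toℕ x) (toℕ y) ∧_) (allᵇ-true m)) (∧-identityʳ _))
      (allᵇ-cong (suc m) λ i → allᵇ-cong (suc m) λ j →
         cong (λ c → not (not (suc (toℕ i) <ᵇ toℕ j) ∧ not (toℕ j <ᵇ suc (toℕ i))) ∨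
                     (if c then (lookup (y ∷ xs) i <ᶠ lookup (y ∷ xs) j)
                           else (lookup (y ∷ xs) j <ᶠ lookup (y ∷ xs) i)))
              (if-not (even (toℕ i)) up))

  alternatesᵛ≡zigzag : ∀ {m} up (xs : Vec (Fin k) m) → alternatesᵛ up xs ≡ zigzag up (values xs)
  alternatesᵛ≡zigzag up []           = refl
  alternatesᵛ≡zigzag up (x ∷ [])     = refl
  alternatesᵛ≡zigzag up (x ∷ y ∷ xs) = trans (alternatesᵛ-∷∷ up x y xs)
    (cong (step up (toℕ x) (toℕ y) ∧_) (alternatesᵛ≡zigzag (not up) (y ∷ xs)))

adjOK≡adjacentOK : ∀ {n} up (π : Word n) i j → adjOK up π i j ≡ OnVectors.adjacentOK up π i j
adjOK≡adjacentOK up π i j with even (toℕ i) | suc (toℕ i) <ᵇ toℕ j | toℕ j <ᵇ suc (toℕ i)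
... | true  | true  | _     = refl
... | true  | false | true  = refl
... | true  | false | false = refl
... | false | true  | _     = refl
... | false | false | true  = refl
... | false | false | false = refl

open OnVectors using (values)

fromValues : ∀ {k} m (L : List ℕ) → isWord k m L ≡ true → Vec (Fin k) m
fromValues zero    []       _ = []
fromValues {k} (suc m) (x ∷ xs) w =
  fromℕ< (<ᵇ-true⁻¹ (∧-projˡ w)) ∷ fromValues m xs (∧-projʳ {x <ᵇ k} w)

values-fromValues : ∀ {k} m L (w : isWord k m L ≡ true) → values (fromValues m L w) ≡ L
values-fromValues zero    []       w = refl
values-fromValues {k} (suc m) (x ∷ xs) w =
  cong₂ _∷_ (toℕ-fromℕ< _) (values-fromValues m xs (∧-projʳ {x <ᵇ k} w))

fromValues-values : ∀ {k m} (v : Vec (Fin k) m) (w : isWord k m (values v) ≡ true) →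
                    fromValues m (values v) w ≡ v
fromValues-values []      w = refl
fromValues-values {k} (x ∷ v) w =
  cong₂ _∷_ (toℕ-injective (toℕ-fromℕ< _)) (fromValues-values v (∧-projʳ {toℕ x <ᵇ k} w))

isWord-values : ∀ {k m} (v : Vec (Fin k) m) → isWord k m (values v) ≡ true
isWord-values []      = refl
isWord-values (x ∷ v) = ∧-intro (<ᵇ-true (toℕ<n x)) (isWord-values v)

Σ-true-≡ : ∀ {A : Set} {f : A → Bool} {x y : A} {p : f x ≡ true} {q : f y ≡ true} →
           x ≡ y → _≡_ {A = Σ A (λ a → f a ≡ true)} (x , p) (y , q)
Σ-true-≡ {p = p} {q} refl = cong (_ ,_) (uip p q)

ListAvoiders : (n : ℕ) → (List ℕ → Bool) → Set
ListAvoiders n Q = Σ (List ℕ) (λ L → isWord n n L ∧ (distinct L ∧ (avoids132ᴸ L ∧ Q L)) ≡ true)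

Avoiders-↔-lists : ∀ n (P : Word n → Bool) (Q : List ℕ → Bool) → (∀ π → P π ≡ Q (values π)) →
                   Avoiders n P ↔ ListAvoiders n Q
Avoiders-↔-lists n P Q P≡Q = mk↔ₛ′ to from (λ (L , _) → Σ-true-≡ (values-fromValues n L _))
                                           (λ (π , _) → Σ-true-≡ (fromValues-values π _))
  where
  conditions : ∀ π → (isPerm π ∧ avoids132 π ∧ P π)
                   ≡ (distinct (values π) ∧ (avoids132ᴸ (values π) ∧ Q (values π)))
  conditions π = cong₂ _∧_ (OnVectors.isPermᵛ≡distinct π)
                           (cong₂ _∧_ (OnVectors.avoids132ᵛ≡avoids132ᴸ π) (P≡Q π))
  to : Avoiders n P → ListAvoiders n Q
  to (π , h) = values π , ∧-intro (isWord-values π) (trans (sym (conditions π)) h)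
  from : ListAvoiders n Q → Avoiders n P
  from (L , h) = fromValues n L w , trans (conditions _)
    (subst (λ L′ → (distinct L′ ∧ (avoids132ᴸ L′ ∧ Q L′)) ≡ true) (sym (values-fromValues n L w))
           (∧-projʳ {isWord n n L} h))
    where
    w : isWord n n L ≡ true
    w = ∧-projˡ h

alternatesFrom≡zigzag : ∀ {n} up (π : Word n) → alternatesFrom up π ≡ zigzag up (values π)
alternatesFrom≡zigzag {n} up π = trans
  (allᵇ-cong n λ i → allᵇ-cong n λ j → adjOK≡adjacentOK up π i j)
  (OnVectors.alternatesᵛ≡zigzag up π)

Σ-true-↔ : ∀ {A : Set} {f g : A → Bool} → (∀ x → f x ≡ g x) →
           Σ A (λ x → f x ≡ true) ↔ Σ A (λ x → g x ≡ true)
Σ-true-↔ f≡g = mk↔ₛ′ (λ (x , p) → x , trans (sym (f≡g x)) p) (λ (x , p) → x , trans (f≡g x) p)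
                     (λ _ → Σ-true-≡ refl) (λ _ → Σ-true-≡ refl)

-- Decomposition around the maximum

+-=ᵇ : ∀ b x y → (b + x =ᵇ b + y) ≡ (x =ᵇ y)
+-=ᵇ b x y rewrite +-<ᵇ b x y | +-<ᵇ b y x = refl

distinct-shift : ∀ b xs → distinct (List.map (b +_) xs) ≡ distinct xs
distinct-shift b []       = refl
distinct-shift b (x ∷ xs) = cong₂ _∧_
  (trans (all-map (b +_) xs) (all-cong xs λ y → cong not (+-=ᵇ b x y)))
  (distinct-shift b xs)

no132From-shift : ∀ b x ys → no132From (b + x) (List.map (b +_) ys) ≡ no132From x ys
no132From-shift b x []       = refl
no132From-shift b x (y ∷ ys) = cong₂ _∧_
  (trans (all-map (b +_) ys) (all-cong ys λ z → cong₂ (λ u v → not (u ∧ v)) (+-<ᵇ b x z) (+-<ᵇ b z y)))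
  (no132From-shift b x ys)

avoids132ᴸ-shift : ∀ b xs → avoids132ᴸ (List.map (b +_) xs) ≡ avoids132ᴸ xs
avoids132ᴸ-shift b []       = refl
avoids132ᴸ-shift b (x ∷ xs) = cong₂ _∧_ (no132From-shift b x xs) (avoids132ᴸ-shift b xs)

step-shift : ∀ up b x y → step up (b + x) (b + y) ≡ step up x y
step-shift true  b x y = +-<ᵇ b x y
step-shift false b x y = +-<ᵇ b y x

zigzag-shift : ∀ up b xs → zigzag up (List.map (b +_) xs) ≡ zigzag up xs
zigzag-shift up b []           = refl
zigzag-shift up b (x ∷ [])     = refl
zigzag-shift up b (x ∷ y ∷ xs) = cong₂ _∧_ (step-shift up b x y) (zigzag-shift (not up) b (y ∷ xs))

valid-shift : ∀ up b xs → valid up (List.map (b +_) xs) ≡ valid up xs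
valid-shift up b xs rewrite distinct-shift b xs | avoids132ᴸ-shift b xs | zigzag-shift up b xs = refl

distinct-++ : ∀ xs ys → (∀ {x y} → x ∈ xs → y ∈ ys → x ≢ y) →
              distinct (xs ++ ys) ≡ distinct xs ∧ distinct ys
distinct-++ []       ys apart = refl
distinct-++ (x ∷ xs) ys apart = begin
  all (x ≠_) (xs ++ ys) ∧ distinct (xs ++ ys)
    ≡⟨ cong₂ _∧_ (all-++ xs ys) (distinct-++ xs ys (apart ∘ there)) ⟩
  (all (x ≠_) xs ∧ all (x ≠_) ys) ∧ (distinct xs ∧ distinct ys)
    ≡⟨ cong (λ b → (all (x ≠_) xs ∧ b) ∧ (distinct xs ∧ distinct ys)) (∈-all ys x≠ys) ⟩
  (all (x ≠_) xs ∧ true) ∧ (distinct xs ∧ distinct ys)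
    ≡⟨ cong (_∧ (distinct xs ∧ distinct ys)) (∧-identityʳ (all (x ≠_) xs)) ⟩
  all (x ≠_) xs ∧ (distinct xs ∧ distinct ys)
    ≡⟨ ∧-assoc (all (x ≠_) xs) _ _ ⟨
  (all (x ≠_) xs ∧ distinct xs) ∧ distinct ys ∎
  where
  x≠ys : ∀ {y} → y ∈ ys → (x ≠ y) ≡ true
  x≠ys y∈ys = cong not (≢⇒=ᵇ-false (apart (here refl) y∈ys))

below-not-between : ∀ {x y z} → z < x → not ((x <ᵇ z) ∧ (z <ᵇ y)) ≡ true
below-not-between {x} {y} {z} z<x rewrite <ᵇ-false (<⇒≤ z<x) = refl

above-not-between : ∀ {x y z} → y ≤ z → not ((x <ᵇ z) ∧ (z <ᵇ y)) ≡ true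
above-not-between {x} {y} {z} y≤z rewrite <ᵇ-false y≤z | ∧-zeroʳ (x <ᵇ z) = refl

no132From-below : ∀ x ys → (∀ {z} → z ∈ ys → z < x) → no132From x ys ≡ true
no132From-below x []       _     = refl
no132From-below x (y ∷ ys) below =
  ∧-intro (∈-all ys (below-not-between {y = y} ∘ below ∘ there)) (no132From-below x ys (below ∘ there))

no132From-++ : ∀ x xs ys → (∀ {y z} → y ∈ xs → z ∈ ys → not ((x <ᵇ z) ∧ (z <ᵇ y)) ≡ true) →
               no132From x ys ≡ true → no132From x (xs ++ ys) ≡ no132From x xs
no132From-++ x []       ys _    no132 = no132
no132From-++ x (y ∷ xs) ys free no132 = begin
  all outside (xs ++ ys) ∧ no132From x (xs ++ ys)
    ≡⟨ cong₂ _∧_ (all-++ xs ys) (no132From-++ x xs ys (free ∘ there) no132) ⟩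
  (all outside xs ∧ all outside ys) ∧ no132From x xs
    ≡⟨ cong (λ b → (all outside xs ∧ b) ∧ no132From x xs) (∈-all ys (free (here refl))) ⟩
  (all outside xs ∧ true) ∧ no132From x xs
    ≡⟨ cong (_∧ no132From x xs) (∧-identityʳ (all outside xs)) ⟩
  all outside xs ∧ no132From x xs ∎
  where
  outside : ℕ → Bool
  outside z = not ((x <ᵇ z) ∧ (z <ᵇ y))

avoids132ᴸ-++ : ∀ xs ys →
  (∀ {x y z} → x ∈ xs → y ∈ xs → z ∈ ys → not ((x <ᵇ z) ∧ (z <ᵇ y)) ≡ true) →
  (∀ {x} → x ∈ xs → no132From x ys ≡ true) →
  avoids132ᴸ (xs ++ ys) ≡ avoids132ᴸ xs ∧ avoids132ᴸ ys
avoids132ᴸ-++ []       ys _    _     = refl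
avoids132ᴸ-++ (x ∷ xs) ys free no132 = begin
  no132From x (xs ++ ys) ∧ avoids132ᴸ (xs ++ ys)
    ≡⟨ cong₂ _∧_ (no132From-++ x xs ys (free (here refl) ∘ there) (no132 (here refl)))
                 (avoids132ᴸ-++ xs ys (λ x∈ y∈ → free (there x∈) (there y∈)) (no132 ∘ there)) ⟩
  no132From x xs ∧ (avoids132ᴸ xs ∧ avoids132ᴸ ys)
    ≡⟨ ∧-assoc (no132From x xs) _ _ ⟨
  (no132From x xs ∧ avoids132ᴸ xs) ∧ avoids132ᴸ ys ∎

-- maxFits up a b: in an alternating word of length a + 1 + b that starts with a rise
-- (if up) or a descent, position a holds a peak (or an endpoint that can be one).
maxFits : Bool → ℕ → ℕ → Bool
maxFits up zero          zero    = true
maxFits up zero          (suc b) = not up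
maxFits up (suc zero)    b       = up ∧ maxFits (not up) zero b
maxFits up (suc (suc a)) b       = maxFits (not up) (suc a) b

zigzag-around-max : ∀ up t xs ys → (∀ {x} → x ∈ xs → x < t) → (∀ {y} → y ∈ ys → y < t) →
  zigzag up (xs ++ t ∷ ys) ≡ maxFits up (length xs) (length ys) ∧ (zigzag up xs ∧ zigzag true ys)
zigzag-around-max up    t []  []       _ _ = refl
zigzag-around-max true  t []  (y ∷ ys) _ ys<t rewrite <ᵇ-false (<⇒≤ (ys<t (here refl))) = refl
zigzag-around-max false t []  (y ∷ ys) _ ys<t rewrite <ᵇ-true (ys<t (here refl)) = refl
zigzag-around-max up t (x ∷ []) ys xs<t ys<t = begin
  step up x t ∧ zigzag (not up) (t ∷ ys)
    ≡⟨ cong₂ _∧_ (step-to-max up) (zigzag-around-max (not up) t [] ys (λ ()) ys<t) ⟩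
  up ∧ (maxFits (not up) 0 (length ys) ∧ zigzag true ys)
    ≡⟨ ∧-assoc up _ _ ⟨
  (up ∧ maxFits (not up) 0 (length ys)) ∧ zigzag true ys ∎
  where
  step-to-max : ∀ up → step up x t ≡ up
  step-to-max true  = <ᵇ-true (xs<t (here refl))
  step-to-max false = <ᵇ-false (<⇒≤ (xs<t (here refl)))
zigzag-around-max up t (x ∷ x′ ∷ xs) ys xs<t ys<t = begin
  step up x x′ ∧ zigzag (not up) (x′ ∷ xs ++ t ∷ ys)
    ≡⟨ cong (step up x x′ ∧_) (zigzag-around-max (not up) t (x′ ∷ xs) ys (xs<t ∘ there) ys<t) ⟩
  step up x x′ ∧ (fits ∧ (zigzag (not up) (x′ ∷ xs) ∧ zigzag true ys))
    ≡⟨ ∧-CM.solve 4 (λ s m z z′ → s ⊕ (m ⊕ (z ⊕ z′)) ⊜ m ⊕ ((s ⊕ z) ⊕ z′)) refl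
                    (step up x x′) fits (zigzag (not up) (x′ ∷ xs)) (zigzag true ys) ⟩
  fits ∧ ((step up x x′ ∧ zigzag (not up) (x′ ∷ xs)) ∧ zigzag true ys) ∎
  where
  fits : Bool
  fits = maxFits (not up) (suc (length xs)) (length ys)

valid-around-max : ∀ up {lo} t xs ys →
  (∀ {x} → x ∈ xs → lo ≤ x × x < t) → (∀ {y} → y ∈ ys → y < lo) → lo ≤ t →
  valid up (xs ++ t ∷ ys) ≡ maxFits up (length xs) (length ys) ∧ (valid up xs ∧ valid true ys)
valid-around-max up {lo} t xs ys xs-between ys<lo lo≤t = begin
  distinct (xs ++ t ∷ ys) ∧ (avoids132ᴸ (xs ++ t ∷ ys) ∧ zigzag up (xs ++ t ∷ ys))
    ≡⟨ cong₂ _∧_ (distinct-++ xs (t ∷ ys) apart)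
         (cong₂ _∧_ (avoids132ᴸ-++ xs (t ∷ ys) free no132) (zigzag-around-max up t xs ys xs<t ys<t)) ⟩
  (distinct xs ∧ distinct (t ∷ ys))
    ∧ ((avoids132ᴸ xs ∧ avoids132ᴸ (t ∷ ys)) ∧ (fits ∧ (zigzag up xs ∧ zigzag true ys)))
    ≡⟨ cong₂ (λ d a → (distinct xs ∧ (d ∧ distinct ys))
                        ∧ ((avoids132ᴸ xs ∧ (a ∧ avoids132ᴸ ys)) ∧ _))
             (∈-all ys (λ y∈ → cong not (>⇒=ᵇ-false (ys<t y∈))))
             (no132From-below t ys ys<t) ⟩
  (distinct xs ∧ distinct ys)
    ∧ ((avoids132ᴸ xs ∧ avoids132ᴸ ys) ∧ (fits ∧ (zigzag up xs ∧ zigzag true ys)))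
    ≡⟨ ∧-CM.solve 7 (λ dx dy ax ay c zx zy → (dx ⊕ dy) ⊕ ((ax ⊕ ay) ⊕ (c ⊕ (zx ⊕ zy))) ⊜
                                           c ⊕ ((dx ⊕ (ax ⊕ zx)) ⊕ (dy ⊕ (ay ⊕ zy)))) refl
                    (distinct xs) (distinct ys) (avoids132ᴸ xs) (avoids132ᴸ ys) fits
                    (zigzag up xs) (zigzag true ys) ⟩
  fits ∧ (valid up xs ∧ valid true ys) ∎
  where
  fits : Bool
  fits = maxFits up (length xs) (length ys)
  xs<t : ∀ {x} → x ∈ xs → x < t
  xs<t = proj₂ ∘ xs-between
  ys<t : ∀ {y} → y ∈ ys → y < t
  ys<t y∈ = <-≤-trans (ys<lo y∈) lo≤t
  ys<xs : ∀ {x y} → x ∈ xs → y ∈ ys → y < x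
  ys<xs x∈ y∈ = <-≤-trans (ys<lo y∈) (proj₁ (xs-between x∈))
  apart : ∀ {x y} → x ∈ xs → y ∈ t ∷ ys → x ≢ y
  apart x∈ (here refl) = <⇒≢ (xs<t x∈)
  apart x∈ (there y∈)  = >⇒≢ (ys<xs x∈ y∈)
  free : ∀ {x y z} → x ∈ xs → y ∈ xs → z ∈ t ∷ ys → not ((x <ᵇ z) ∧ (z <ᵇ y)) ≡ true
  free {x} {y} x∈ y∈ (here refl) = above-not-between {x} (<⇒≤ (xs<t y∈))
  free {x} {y} x∈ y∈ (there z∈)  = below-not-between {y = y} (ys<xs x∈ z∈)
  no132 : ∀ {x} → x ∈ xs → no132From x (t ∷ ys) ≡ true
  no132 x∈ = ∧-intro (∈-all ys (below-not-between {y = t} ∘ ys<xs x∈)) (no132From-below _ ys (ys<xs x∈))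

distinct-lookup-injective : ∀ L → distinct L ≡ true →
                            ∀ {i j} → List.lookup L i ≡ List.lookup L j → i ≡ j
distinct-lookup-injective (x ∷ xs) d {fzero}  {fzero}  _ = refl
distinct-lookup-injective (x ∷ xs) d {fzero}  {fsuc j} x≡ =
  contradiction x≡ (≠⇒≢ (all-∈ {p = x ≠_} {xs} (∧-projˡ {all (x ≠_) xs} d)
                                      (∈-lookup {xs = xs} j)))
distinct-lookup-injective (x ∷ xs) d {fsuc i} {fzero}  ≡x =
  contradiction (sym ≡x) (≠⇒≢ (all-∈ {p = x ≠_} {xs} (∧-projˡ {all (x ≠_) xs} d)
                                            (∈-lookup {xs = xs} i)))
distinct-lookup-injective (x ∷ xs) d {fsuc i} {fsuc j} eq =
  cong fsuc (distinct-lookup-injective xs (∧-projʳ {all _ xs} d) eq)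

distinct-length≤ : ∀ {lo hi} L → distinct L ≡ true → (∀ {x} → x ∈ L → lo ≤ x × x < hi) →
                   length L ≤ hi ∸ lo
distinct-length≤ {lo} {hi} L d bounds = injective⇒≤ injective
  where
  shifted<width : ∀ i → List.lookup L i ∸ lo < hi ∸ lo
  shifted<width i = ∸-monoˡ-< (proj₂ (bounds (∈-lookup i))) (proj₁ (bounds (∈-lookup i)))
  f : Fin (length L) → Fin (hi ∸ lo)
  f i = fromℕ< (shifted<width i)
  injective : ∀ {i j} → f i ≡ f j → i ≡ j
  injective {i} {j} fi≡fj = distinct-lookup-injective L d
    (∸-cancelʳ-≡ (proj₁ (bounds (∈-lookup i))) (proj₁ (bounds (∈-lookup j)))
      (trans (sym (toℕ-fromℕ< (shifted<width i)))
             (trans (cong toℕ fi≡fj) (toℕ-fromℕ< (shifted<width j)))))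

distinct-++⁻ : ∀ xs ys → distinct (xs ++ ys) ≡ true → ∀ {x y} → x ∈ xs → y ∈ ys → x ≢ y
distinct-++⁻ (x ∷ xs) ys d (here refl) y∈ =
  ≠⇒≢ (all-∈ {p = x ≠_} (∧-projˡ {all (x ≠_) (xs ++ ys)} d) (∈-++⁺ʳ xs y∈))
distinct-++⁻ (x ∷ xs) ys d (there x∈) y∈ =
  distinct-++⁻ xs ys (∧-projʳ {all _ (xs ++ ys)} d) x∈ y∈

avoids132ᴸ-++⁻ : ∀ xs ys → avoids132ᴸ (xs ++ ys) ≡ true →
                 ∀ {x} → x ∈ xs → no132From x ys ≡ true
avoids132ᴸ-++⁻ (x ∷ xs) ys a (here refl) = no132From-suffix xs (∧-projˡ a)
  where
  no132From-suffix : ∀ xs → no132From x (xs ++ ys) ≡ true → no132From x ys ≡ true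
  no132From-suffix []       h = h
  no132From-suffix (y ∷ xs) h = no132From-suffix xs (∧-projʳ {all _ (xs ++ ys)} h)
avoids132ᴸ-++⁻ (x ∷ xs) ys a (there x∈) =
  avoids132ᴸ-++⁻ xs ys (∧-projʳ {no132From x (xs ++ ys)} a) x∈

isWord-length : ∀ {k} m L → isWord k m L ≡ true → length L ≡ m
isWord-length zero    []       _ = refl
isWord-length {k} (suc m) (x ∷ xs) w = cong suc (isWord-length m xs (∧-projʳ {x <ᵇ k} w))

isWord-∈ : ∀ {k} m L → isWord k m L ≡ true → ∀ {x} → x ∈ L → x < k
isWord-∈ (suc m) (x ∷ xs) w (here refl) = <ᵇ-true⁻¹ (∧-projˡ w)
isWord-∈ {k} (suc m) (x ∷ xs) w (there x∈)  = isWord-∈ m xs (∧-projʳ {x <ᵇ k} w) x∈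

isWord-intro : ∀ {k} m L → length L ≡ m → (∀ {x} → x ∈ L → x < k) → isWord k m L ≡ true
isWord-intro zero    []       _   _    = refl
isWord-intro (suc m) (x ∷ xs) len bound =
  ∧-intro (<ᵇ-true (bound (here refl))) (isWord-intro m xs (suc-injective len) (bound ∘ there))

breakAt : ℕ → List ℕ → List ℕ × List ℕ
breakAt v []       = [] , []
breakAt v (x ∷ xs) with x ≟ v
... | yes _ = [] , xs
... | no  _ = x ∷ proj₁ (breakAt v xs) , proj₂ (breakAt v xs)

breakAt-∈ : ∀ {v} L → v ∈ L → proj₁ (breakAt v L) ++ v ∷ proj₂ (breakAt v L) ≡ L
breakAt-∈ {v} (x ∷ xs) v∈ with x ≟ v | v∈
... | yes refl | _          = refl
... | no  x≢v  | here refl  = contradiction refl x≢v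
... | no  _    | there v∈xs = cong (x ∷_) (breakAt-∈ xs v∈xs)

breakAt-++ : ∀ {v} xs ys → (∀ {x} → x ∈ xs → x ≢ v) → breakAt v (xs ++ v ∷ ys) ≡ (xs , ys)
breakAt-++ {v} []       ys _ with v ≟ v
... | yes _   = refl
... | no  v≢v = contradiction refl v≢v
breakAt-++ {v} (x ∷ xs) ys x≢v with x ≟ v
... | yes x≡v = contradiction x≡v (x≢v (here refl))
... | no  _   =
  cong (λ (p : List ℕ × List ℕ) → x ∷ proj₁ p , proj₂ p) (breakAt-++ xs ys (x≢v ∘ there))

not-between⇒≤ : ∀ {x y z} → z < y → not ((x <ᵇ z) ∧ (z <ᵇ y)) ≡ true → z ≤ x
not-between⇒≤ {x} {y} {z} z<y h rewrite <ᵇ-true z<y | ∧-identityʳ (x <ᵇ z) with x <ᵇ z in x<ᵇz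
... | false = <ᵇ-false⁻¹ x<ᵇz

validOn : Bool → ℕ → List ℕ → Bool
validOn up n L = isWord n n L ∧ valid up L

Avoidersᴸ : Bool → ℕ → Set
Avoidersᴸ up n = Σ (List ℕ) (λ L → validOn up n L ≡ true)

DiagΣ : ℕ → (ℕ → ℕ → Set) → Set
DiagΣ m P = Σ ℕ λ a → Σ ℕ λ b → (a + b ≡ m) × P a b

Pieces : Bool → ℕ → ℕ → Set
Pieces up a b = (maxFits up a b ≡ true) × (Avoidersᴸ up a × Avoidersᴸ true b)

module Decompose (up : Bool) (m : ℕ) (L : List ℕ) (valid-L : validOn up (suc m) L ≡ true) where

  private
    word : isWord (suc m) (suc m) L ≡ true
    word = ∧-projˡ valid-L
    L<suc-m : ∀ {x} → x ∈ L → x < suc m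
    L<suc-m = isWord-∈ (suc m) L word

  -- otherwise L lists m + 1 distinct values below m
  m∈L : m ∈ L
  m∈L with m ∈? L
  ... | yes m∈L = m∈L
  ... | no  m∉L = contradiction
    (distinct-length≤ {0} {m} L (∧-projˡ (∧-projʳ {isWord (suc m) (suc m) L} valid-L))
                      (λ x∈ → z≤n , ≤∧≢⇒< (s≤s⁻¹ (L<suc-m x∈)) (λ { refl → m∉L x∈ })))
    (subst (_≰ m) (sym (isWord-length (suc m) L word)) (n≮n m))

  prefix suffix : List ℕ
  prefix = proj₁ (breakAt m L)
  suffix = proj₂ (breakAt m L)

  a b : ℕ
  a = length prefix
  b = length suffix

  split≡L : prefix ++ m ∷ suffix ≡ L
  split≡L = breakAt-∈ L m∈L

  a+b≡m : a + b ≡ m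
  a+b≡m = suc-injective (begin
    suc (a + b)                    ≡⟨ +-suc a b ⟨
    a + suc b                      ≡⟨ length-++ prefix ⟨
    length (prefix ++ m ∷ suffix)  ≡⟨ cong length split≡L ⟩
    length L                       ≡⟨ isWord-length (suc m) L word ⟩
    suc m                          ∎)

  private
    valid-split : valid up (prefix ++ m ∷ suffix) ≡ true
    valid-split = subst (λ L′ → valid up L′ ≡ true) (sym split≡L)
                        (∧-projʳ {isWord (suc m) (suc m) L} valid-L)
    distinct-split : distinct (prefix ++ m ∷ suffix) ≡ true
    distinct-split = ∧-projˡ {distinct (prefix ++ m ∷ suffix)} valid-split
    apart : ∀ {x y} → x ∈ prefix → y ∈ m ∷ suffix → x ≢ y
    apart = distinct-++⁻ prefix (m ∷ suffix) distinct-split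
    distinct-m∷suffix : distinct (m ∷ suffix) ≡ true
    distinct-m∷suffix = ∧-projʳ {distinct prefix}
      (trans (sym (distinct-++ prefix (m ∷ suffix) apart)) distinct-split)
    split<suc-m : ∀ {x} → x ∈ prefix ++ m ∷ suffix → x < suc m
    split<suc-m x∈ = L<suc-m (subst (_ ∈_) split≡L x∈)

    prefix<m : ∀ {x} → x ∈ prefix → x < m
    prefix<m x∈ = ≤∧≢⇒< (s≤s⁻¹ (split<suc-m (∈-++⁺ˡ x∈))) (apart x∈ (here refl))
    suffix<m : ∀ {z} → z ∈ suffix → z < m
    suffix<m z∈ = ≤∧≢⇒< (s≤s⁻¹ (split<suc-m (∈-++⁺ʳ prefix (there z∈))))
      (≢-sym (≠⇒≢ (all-∈ (∧-projˡ {all (m ≠_) suffix} distinct-m∷suffix) z∈)))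

  -- the 1-3-2 pattern x m z is excluded
  suffix<prefix : ∀ {x z} → x ∈ prefix → z ∈ suffix → z < x
  suffix<prefix {x} {z} x∈ z∈ =
    ≤∧≢⇒< (not-between⇒≤ (suffix<m z∈) not-between) (≢-sym (apart x∈ (there z∈)))
    where
    no132 : no132From x (m ∷ suffix) ≡ true
    no132 = avoids132ᴸ-++⁻ prefix (m ∷ suffix)
              (∧-projˡ (∧-projʳ {distinct (prefix ++ m ∷ suffix)} valid-split)) x∈
    not-between : not ((x <ᵇ z) ∧ (z <ᵇ m)) ≡ true
    not-between = all-∈ (∧-projˡ {all (λ z → not ((x <ᵇ z) ∧ (z <ᵇ m))) suffix} no132) z∈

  -- The values below x are at least the b entries of the suffix, and those above a suffix
  -- entry z are at least m and the a entries of the prefix.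
  b≤prefix : ∀ {x} → x ∈ prefix → b ≤ x
  b≤prefix x∈ = distinct-length≤ {0} suffix (∧-projʳ {all (m ≠_) suffix} distinct-m∷suffix)
                                 (λ z∈ → z≤n , suffix<prefix x∈ z∈)

  suffix<b : ∀ {z} → z ∈ suffix → z < b
  suffix<b {z} z∈ = +-cancelˡ-≤ a (suc z) b (subst₂ _≤_ (sym (+-suc a z))
    (trans (m∸n+n≡m (<⇒≤ (suffix<m z∈))) (sym a+b≡m))
    (+-monoˡ-≤ z (distinct-length≤ (m ∷ prefix) distinct-m∷prefix bounds)))
    where
    distinct-m∷prefix : distinct (m ∷ prefix) ≡ true
    distinct-m∷prefix = ∧-intro
      (∈-all prefix (λ x∈ → cong not (≢⇒=ᵇ-false (≢-sym (apart x∈ (here refl))))))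
      (∧-projˡ (trans (sym (distinct-++ prefix (m ∷ suffix) apart)) distinct-split))
    bounds : ∀ {x} → x ∈ m ∷ prefix → suc z ≤ x × x < suc m
    bounds (here refl) = suffix<m z∈ , ≤-refl
    bounds (there x∈)  = suffix<prefix x∈ z∈ , m<n⇒m<1+n (prefix<m x∈)

  private
    fits-and-valid : maxFits up a b ∧ (valid up prefix ∧ valid true suffix) ≡ true
    fits-and-valid = trans
      (sym (valid-around-max up m prefix suffix (λ x∈ → b≤prefix x∈ , prefix<m x∈) suffix<b
                             (subst (b ≤_) a+b≡m (m≤n+m b a))))
      valid-split

  lowered : List ℕ
  lowered = List.map (_∸ b) prefix

  raise-lowered : List.map (b +_) lowered ≡ prefix
  raise-lowered = raise prefix (λ x∈ → b≤prefix x∈)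
    where
    raise : ∀ xs → (∀ {x} → x ∈ xs → b ≤ x) → List.map (b +_) (List.map (_∸ b) xs) ≡ xs
    raise []       _   = refl
    raise (x ∷ xs) b≤ = cong₂ _∷_ (m+[n∸m]≡n (b≤ (here refl))) (raise xs (b≤ ∘ there))

  lowered-valid : validOn up a lowered ≡ true
  lowered-valid = ∧-intro
    (isWord-intro a lowered (length-map (_∸ b) prefix) lowered<a)
    (trans (sym (valid-shift up b lowered))
           (trans (cong (valid up) raise-lowered) (∧-projˡ (∧-projʳ {maxFits up a b} fits-and-valid))))
    where
    lowered<a : ∀ {y} → y ∈ lowered → y < a
    lowered<a y∈ with ∈-map⁻ (_∸ b) y∈
    ... | x , x∈ , refl = subst (x ∸ b <_) (m+n∸n≡m a b)
      (∸-monoˡ-< (subst (x <_) (sym a+b≡m) (prefix<m x∈)) (b≤prefix x∈))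

  suffix-valid : validOn true b suffix ≡ true
  suffix-valid = ∧-intro (isWord-intro b suffix refl suffix<b)
                         (∧-projʳ {valid up prefix} (∧-projʳ {maxFits up a b} fits-and-valid))

  decomposition : DiagΣ m (Pieces up)
  decomposition = a , b , a+b≡m , ∧-projˡ fits-and-valid , (lowered , lowered-valid) , (suffix , suffix-valid)


raised<a+b : ∀ {a b α x} → isWord a a α ≡ true → x ∈ List.map (b +_) α → x < a + b
raised<a+b {a} {b} {α} word x∈ with ∈-map⁻ (b +_) x∈
... | y , y∈ , refl = subst (b + y <_) (+-comm b a) (+-monoʳ-< b (isWord-∈ a α word y∈))

assembled-valid : ∀ {up a b m} α β → a + b ≡ m → maxFits up a b ≡ true →
  validOn up a α ≡ true → validOn true b β ≡ true →
  validOn up (suc m) (List.map (b +_) α ++ m ∷ β) ≡ true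
assembled-valid {up} {a} {b} α β refl fits α-valid β-valid =
  ∧-intro (isWord-intro (suc (a + b)) _ length-assembled bounded) (begin
    valid up (List.map (b +_) α ++ (a + b) ∷ β)
      ≡⟨ valid-around-max up (a + b) (List.map (b +_) α) β
           (λ x∈ → raised≥b x∈ , raised<a+b (∧-projˡ α-valid) x∈) β<b (m≤n+m b a) ⟩
    maxFits up (length (List.map (b +_) α)) (length β) ∧ (valid up (List.map (b +_) α) ∧ valid true β)
      ≡⟨ cong₂ (λ i j → maxFits up i j ∧ (valid up (List.map (b +_) α) ∧ valid true β))
               (trans (length-map (b +_) α) α-length) β-length ⟩
    maxFits up a b ∧ (valid up (List.map (b +_) α) ∧ valid true β)
      ≡⟨ cong (λ v → maxFits up a b ∧ (v ∧ valid true β)) (valid-shift up b α) ⟩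
    maxFits up a b ∧ (valid up α ∧ valid true β)
      ≡⟨ ∧-intro fits (∧-intro (∧-projʳ {isWord a a α} α-valid)
                               (∧-projʳ {isWord b b β} β-valid)) ⟩
    true ∎)
  where
  α-length : length α ≡ a
  α-length = isWord-length a α (∧-projˡ α-valid)
  β-length : length β ≡ b
  β-length = isWord-length b β (∧-projˡ β-valid)
  β<b : ∀ {y} → y ∈ β → y < b
  β<b = isWord-∈ b β (∧-projˡ β-valid)
  raised≥b : ∀ {x} → x ∈ List.map (b +_) α → b ≤ x
  raised≥b x∈ with ∈-map⁻ (b +_) x∈
  ... | y , _ , refl = m≤m+n b y
  length-assembled : length (List.map (b +_) α ++ (a + b) ∷ β) ≡ suc (a + b)
  length-assembled = begin
    length (List.map (b +_) α ++ (a + b) ∷ β)     ≡⟨ length-++ (List.map (b +_) α) ⟩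
    length (List.map (b +_) α) + suc (length β)   ≡⟨ cong₂ (λ i j → i + suc j)
                                                           (trans (length-map (b +_) α) α-length) β-length ⟩
    a + suc b                                     ≡⟨ +-suc a b ⟩
    suc (a + b)                                   ∎
  bounded : ∀ {x} → x ∈ List.map (b +_) α ++ (a + b) ∷ β → x < suc (a + b)
  bounded x∈ with ∈-++⁻ (List.map (b +_) α) x∈
  ... | inj₁ x∈raised    = m<n⇒m<1+n (raised<a+b (∧-projˡ α-valid) x∈raised)
  ... | inj₂ (here refl) = ≤-refl
  ... | inj₂ (there x∈β) = m<n⇒m<1+n (<-≤-trans (β<b x∈β) (m≤n+m b a))

assemble : ∀ {up m} → DiagΣ m (Pieces up) → Avoidersᴸ up (suc m)
assemble {m = m} (a , b , a+b≡m , fits , (α , α-valid) , (β , β-valid)) =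
  List.map (b +_) α ++ m ∷ β , assembled-valid α β a+b≡m fits α-valid β-valid

decompose : ∀ {up m} → Avoidersᴸ up (suc m) → DiagΣ m (Pieces up)
decompose {up} {m} (L , valid-L) = Decompose.decomposition up m L valid-L

assemble-decompose : ∀ {up m} (π : Avoidersᴸ up (suc m)) → assemble (decompose π) ≡ π
assemble-decompose {up} {m} (L , valid-L) =
  Σ-true-≡ (trans (cong (_++ m ∷ suffix) raise-lowered) split≡L)
  where open Decompose up m L valid-L

DiagΣ-Pieces-≡ : ∀ {up m a a′ b b′ α α′ β β′} {e : a + b ≡ m} {e′ : a′ + b′ ≡ m}
  {fits : maxFits up a b ≡ true} {fits′ : maxFits up a′ b′ ≡ true}
  {α-valid : validOn up a α ≡ true} {α′-valid : validOn up a′ α′ ≡ true}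
  {β-valid : validOn true b β ≡ true} {β′-valid : validOn true b′ β′ ≡ true} →
  a ≡ a′ → b ≡ b′ → α ≡ α′ → β ≡ β′ →
  _≡_ {A = DiagΣ m (Pieces up)} (a , b , e , fits , (α , α-valid) , (β , β-valid))
                                (a′ , b′ , e′ , fits′ , (α′ , α′-valid) , (β′ , β′-valid))
DiagΣ-Pieces-≡ {e = e} {e′} {fits} {fits′} {α-valid} {α′-valid} {β-valid} {β′-valid}
               refl refl refl refl
  rewrite uip e e′ | uip fits fits′ | uip α-valid α′-valid | uip β-valid β′-valid = refl

decompose-assemble : ∀ {up m} (p : DiagΣ m (Pieces up)) → decompose (assemble p) ≡ p
decompose-assemble {up} {m} (a , b , a+b≡m , fits , (α , α-valid) , (β , β-valid)) =
  DiagΣ-Pieces-≡ (trans (cong (length ∘ proj₁) broken) (trans (length-map (b +_) α) α-length))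
                 (trans (cong (length ∘ proj₂) broken) β-length)
                 (trans (cong (λ p → List.map (_∸ length (proj₂ p)) (proj₁ p)) broken)
                        (trans (cong (λ c → List.map (_∸ c) (List.map (b +_) α)) β-length) (lower-raise α)))
                 (cong proj₂ broken)
  where
  α-length : length α ≡ a
  α-length = isWord-length a α (∧-projˡ α-valid)
  β-length : length β ≡ b
  β-length = isWord-length b β (∧-projˡ β-valid)
  broken : breakAt m (List.map (b +_) α ++ m ∷ β) ≡ (List.map (b +_) α , β)
  broken = breakAt-++ (List.map (b +_) α) β
    (λ x∈ → <⇒≢ (subst (_ <_) a+b≡m (raised<a+b (∧-projˡ α-valid) x∈)))
  lower-raise : ∀ xs → List.map (_∸ b) (List.map (b +_) xs) ≡ xs
  lower-raise []       = refl
  lower-raise (x ∷ xs) = cong₂ _∷_ (m+n∸m≡n b x) (lower-raise xs)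

decomposition-↔ : ∀ {up m} → Avoidersᴸ up (suc m) ↔ DiagΣ m (Pieces up)
decomposition-↔ = mk↔ₛ′ decompose assemble decompose-assemble assemble-decompose

if-true : ∀ {c} {x y : ℕ} → c ≡ true → (if c then x else y) ≡ x
if-true refl = refl

if-false : ∀ {c} {x y : ℕ} → c ≡ false → (if c then x else y) ≡ y
if-false refl = refl

↔-count : ∀ {A : Set} {k l} → A ↔ Fin k → k ≡ l → A ↔ Fin l
↔-count A↔k refl = A↔k

guarded-↔ : ∀ c {A : Set} {k} → A ↔ Fin k → ((c ≡ true) × A) ↔ Fin (if c then k else 0)
guarded-↔ true  A↔k = ↔-trans (mk↔ₛ′ proj₂ (refl ,_) (λ _ → refl) (λ { (refl , _) → refl })) A↔k
guarded-↔ false _   = mk↔ₛ′ (λ ()) (λ ()) (λ ()) (λ ())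

DiagΣ-↔ : ∀ m (P : ℕ → ℕ → Set) (g : ℕ → ℕ → ℕ) →
          (∀ a b → a + b ≡ m → P a b ↔ Fin (g a b)) → DiagΣ m P ↔ Fin (diagSum m g)
DiagΣ-↔ zero P g P↔g =
  ↔-trans (mk↔ₛ′ to (λ p → 0 , 0 , refl , p) (λ _ → refl) from-to) (P↔g 0 0 refl)
  where
  to : DiagΣ 0 P → P 0 0
  to (zero , zero , refl , p) = p
  from-to : ∀ x → (0 , 0 , refl , to x) ≡ x
  from-to (zero , zero , refl , p) = refl
DiagΣ-↔ (suc m) P g P↔g = ↔-trans (mk↔ₛ′ to from to-from from-to)
  (↔-trans (P↔g 0 (suc m) refl
            ⊎-↔ DiagΣ-↔ m (P ∘ suc) (g ∘ suc) (λ a b e → P↔g (suc a) b (cong suc e)))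
           (↔-sym +↔⊎))
  where
  to : DiagΣ (suc m) P → P 0 (suc m) ⊎ DiagΣ m (P ∘ suc)
  to (zero  , b , refl , p) = inj₁ p
  to (suc a , b , e    , p) = inj₂ (a , b , suc-injective e , p)
  from : P 0 (suc m) ⊎ DiagΣ m (P ∘ suc) → DiagΣ (suc m) P
  from (inj₁ p)               = 0 , suc m , refl , p
  from (inj₂ (a , b , e , p)) = suc a , b , cong suc e , p
  to-from : ∀ y → to (from y) ≡ y
  to-from (inj₁ p)               = refl
  to-from (inj₂ (a , b , e , p)) = cong (λ e′ → inj₂ (a , b , e′ , p)) (uip _ _)
  from-to : ∀ x → from (to x) ≡ x
  from-to (zero  , b , refl , p) = refl
  from-to (suc a , b , e    , p) = cong (λ e′ → suc a , b , e′ , p) (uip _ _)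

Σ-guarded-↔ : ∀ {A : Set} (f : A → Bool) c →
              Σ A (λ x → c ∧ f x ≡ true) ↔ ((c ≡ true) × Σ A (λ x → f x ≡ true))
Σ-guarded-↔ f true  = mk↔ₛ′ (refl ,_) proj₂ (λ { (refl , _) → refl }) (λ _ → refl)
Σ-guarded-↔ f false = mk↔ₛ′ (λ { (_ , ()) }) (λ { (() , _) }) (λ { (() , _) }) (λ { (_ , ()) })

maxFits-odd : ∀ up i b → maxFits up (suc (double i)) b ≡ up
maxFits-odd up zero    zero    = ∧-identityʳ up
maxFits-odd up zero    (suc b) = trans (cong (up ∧_) (not-involutive up)) (∧-idem up)
maxFits-odd up (suc i) b       = trans (maxFits-odd (not (not up)) i b) (not-involutive up)

maxFits-even : ∀ up i b → maxFits up (double (suc i)) b ≡ not up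
maxFits-even up i b = maxFits-odd (not up) i b

avoiderCount : Bool → ℕ → ℕ
avoiderCount true  n = ballot ⌊ n /2⌋ ⌊ n /2⌋
avoiderCount false n = ballot ⌈ n /2⌉ ⌈ n /2⌉

maxAtCount : Bool → ℕ → ℕ → ℕ
maxAtCount up a b = if maxFits up a b then avoiderCount up a * avoiderCount true b else 0

diagSum-segner : ∀ k f → (∀ i j → i + j ≡ k → f i j ≡ ballot i i * ballot j j) →
                 diagSum k f ≡ ballot (suc k) (suc k)
diagSum-segner k f f≡ = trans (diagSum-cong k f≡) (sym (ballot-segner k))

recurrence-up-odd : ∀ k → diagSum (double (suc k)) (maxAtCount true) ≡ ballot (suc k) (suc k)
recurrence-up-odd k = begin
  diagSum (double (suc k)) (maxAtCount true)
    ≡⟨ diagSum-double (suc k) (maxAtCount true) ⟩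
  diagSum (suc k) (λ i j → maxAtCount true (double i) (double j)) + diagSumOdd (suc k) (maxAtCount true)
    ≡⟨ cong₂ _+_ (diagSum-zero (suc k) _ evens) (diagSum-segner k _ odds) ⟩
  ballot (suc k) (suc k) ∎
  where
  evens : ∀ i j → i + j ≡ suc k → maxAtCount true (double i) (double j) ≡ 0
  evens zero    (suc j) _ = refl
  evens (suc i) j       _ rewrite maxFits-even true i (double j) = refl
  odds : ∀ i j → i + j ≡ k → maxAtCount true (suc (double i)) (suc (double j)) ≡ ballot i i * ballot j j
  odds i j _ rewrite maxFits-odd true i (suc (double j)) | ⌊suc-double/2⌋ i | ⌊suc-double/2⌋ j = refl

recurrence-up-even : ∀ k → diagSum (suc (double k)) (maxAtCount true) ≡ ballot (suc k) (suc k)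
recurrence-up-even k = begin
  diagSum (suc (double k)) (maxAtCount true)
    ≡⟨ diagSum-suc-double k (maxAtCount true) ⟩
  diagSum k (λ i j → maxAtCount true (double i) (suc (double j)))
    + diagSum k (λ i j → maxAtCount true (suc (double i)) (double j))
    ≡⟨ cong₂ _+_ (diagSum-zero k _ evens) (diagSum-segner k _ odds) ⟩
  ballot (suc k) (suc k) ∎
  where
  evens : ∀ i j → i + j ≡ k → maxAtCount true (double i) (suc (double j)) ≡ 0
  evens zero    j _ = refl
  evens (suc i) j _ rewrite maxFits-even true i (suc (double j)) = refl
  odds : ∀ i j → i + j ≡ k → maxAtCount true (suc (double i)) (double j) ≡ ballot i i * ballot j j
  odds i j _ rewrite maxFits-odd true i (double j) | ⌊suc-double/2⌋ i | ⌊double/2⌋ j = refl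

recurrence-down-odd : ∀ k → diagSum (double k) (maxAtCount false) ≡ ballot (suc k) (suc k)
recurrence-down-odd k = begin
  diagSum (double k) (maxAtCount false)
    ≡⟨ diagSum-double k (maxAtCount false) ⟩
  diagSum k (λ i j → maxAtCount false (double i) (double j)) + diagSumOdd k (maxAtCount false)
    ≡⟨ cong₂ _+_ (diagSum-segner k _ evens) (odds k) ⟩
  ballot (suc k) (suc k) + 0
    ≡⟨ +-identityʳ _ ⟩
  ballot (suc k) (suc k) ∎
  where
  evens : ∀ i j → i + j ≡ k → maxAtCount false (double i) (double j) ≡ ballot i i * ballot j j
  evens zero    zero    _ = refl
  evens zero    (suc j) _ rewrite ⌊double/2⌋ j = refl
  evens (suc i) j       _ rewrite maxFits-even false i (double j) | ⌊suc-double/2⌋ i | ⌊double/2⌋ j = refl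
  odds : ∀ k → diagSumOdd k (maxAtCount false) ≡ 0
  odds zero    = refl
  odds (suc k) = diagSum-zero k _ λ i j _ →
    cong (λ c → if c then avoiderCount false (suc (double i)) * avoiderCount true (suc (double j)) else 0)
         (maxFits-odd false i (suc (double j)))

recurrence-down-even : ∀ k → diagSum (suc (double k)) (maxAtCount false) ≡ ballot (suc k) (suc k)
recurrence-down-even k = begin
  diagSum (suc (double k)) (maxAtCount false)
    ≡⟨ diagSum-suc-double k (maxAtCount false) ⟩
  diagSum k (λ i j → maxAtCount false (double i) (suc (double j)))
    + diagSum k (λ i j → maxAtCount false (suc (double i)) (double j))
    ≡⟨ cong₂ _+_ (diagSum-segner k _ evens) (diagSum-zero k _ odds) ⟩
  ballot (suc k) (suc k) + 0
    ≡⟨ +-identityʳ _ ⟩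
  ballot (suc k) (suc k) ∎
  where
  evens : ∀ i j → i + j ≡ k → maxAtCount false (double i) (suc (double j)) ≡ ballot i i * ballot j j
  evens zero    j _ rewrite ⌊suc-double/2⌋ j = refl
  evens (suc i) j _ rewrite maxFits-even false i (suc (double j)) | ⌊suc-double/2⌋ i | ⌊suc-double/2⌋ j = refl
  odds : ∀ i j → i + j ≡ k → maxAtCount false (suc (double i)) (double j) ≡ 0
  odds i j _ rewrite maxFits-odd false i (double j) = refl

avoiderCount-suc : ∀ up m → diagSum m (maxAtCount up) ≡ avoiderCount up (suc m)
avoiderCount-suc up m with even-or-odd m
avoiderCount-suc true  _ | inj₁ (zero  , refl) = refl
avoiderCount-suc true  _ | inj₁ (suc k , refl) =
  trans (recurrence-up-odd k) (cong (λ h → ballot h h) (sym (⌊suc-double/2⌋ (suc k))))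
avoiderCount-suc true  _ | inj₂ (k     , refl) =
  trans (recurrence-up-even k) (cong (λ h → ballot h h) (sym (⌊double/2⌋ (suc k))))
avoiderCount-suc false _ | inj₁ (k     , refl) =
  trans (recurrence-down-odd k) (cong (λ h → ballot h h) (sym (⌊double/2⌋ (suc k))))
avoiderCount-suc false _ | inj₂ (k     , refl) =
  trans (recurrence-down-even k) (cong (λ h → ballot h h) (sym (⌊suc-double/2⌋ (suc k))))

Avoidersᴸ-zero : ∀ up → Avoidersᴸ up 0 ↔ Fin 1
Avoidersᴸ-zero up =
  mk↔ₛ′ (λ _ → fzero) (λ _ → [] , refl) (λ { fzero → refl ; (fsuc ()) }) λ { ([] , refl) → refl }

Avoidersᴸ-↔ : ∀ up n → Avoidersᴸ up n ↔ Fin (avoiderCount up n)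
Avoidersᴸ-↔ up n = <-rec (λ n → ∀ up → Avoidersᴸ up n ↔ Fin (avoiderCount up n)) count n up
  where
  count : ∀ n → (∀ {k} → k < n → ∀ up → Avoidersᴸ up k ↔ Fin (avoiderCount up k)) →
          ∀ up → Avoidersᴸ up n ↔ Fin (avoiderCount up n)
  count zero    _   true  = Avoidersᴸ-zero true
  count zero    _   false = Avoidersᴸ-zero false
  count (suc m) rec up = ↔-trans decomposition-↔ (↔-count
    (DiagΣ-↔ m (Pieces up) (maxAtCount up) λ a b a+b≡m →
      guarded-↔ (maxFits up a b)
        (↔-trans (rec (s≤s (subst (a ≤_) a+b≡m (m≤m+n a b))) up
                  ×-↔ rec (s≤s (subst (b ≤_) a+b≡m (m≤n+m b a))) true)
                 (↔-sym *↔×)))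
    (avoiderCount-suc up m))

alternating-↔ : ∀ n → Avoiders n alternating ↔ Fin (avoiderCount true n)
alternating-↔ n = ↔-trans (Avoiders-↔-lists n alternating (zigzag true) (alternatesFrom≡zigzag true))
                          (Avoidersᴸ-↔ true n)

alternatingClass-↔ : ∀ n up c →
  Avoiders n (λ π → alternatesFrom up π ∧ c) ↔ Fin (if c then avoiderCount up n else 0)
alternatingClass-↔ n up c =
  ↔-trans (Avoiders-↔-lists n _ (λ L → zigzag up L ∧ c)
                             (λ π → cong (_∧ c) (alternatesFrom≡zigzag up π)))
  (↔-trans (Σ-true-↔ λ L →
     ∧-CM.solve 5 (λ w d a z c → w ⊕ (d ⊕ (a ⊕ (z ⊕ c))) ⊜ c ⊕ (w ⊕ (d ⊕ (a ⊕ z)))) refl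
                  (isWord n n L) (distinct L) (avoids132ᴸ L) (zigzag up L) c)
  (↔-trans (Σ-guarded-↔ (validOn up n) c)
           (guarded-↔ c (Avoidersᴸ-↔ up n))))

n/2≡⌊n/2⌋ : ∀ n → n / 2 ≡ ⌊ n /2⌋
n/2≡⌊n/2⌋ zero          = refl
n/2≡⌊n/2⌋ (suc zero)    = refl
n/2≡⌊n/2⌋ (suc (suc n)) =
  trans (m/n≡1+[m∸n]/n {suc (suc n)} {2} (s≤s (s≤s z≤n))) (cong suc (n/2≡⌊n/2⌋ n))

catalan≡ballot⌊n/2⌋ : ∀ n → catalan (n / 2) ≡ ballot ⌊ n /2⌋ ⌊ n /2⌋
catalan≡ballot⌊n/2⌋ n rewrite n/2≡⌊n/2⌋ n = catalan≡ballot ⌊ n /2⌋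

even-double : ∀ k → even (double k) ≡ true
even-double zero    = refl
even-double (suc k) rewrite even-double k = refl

catalanHalf-double : ∀ k → catalanHalf (double k) ≡ ballot k k
catalanHalf-double k rewrite even-double k =
  trans (catalan≡ballot⌊n/2⌋ (double k)) (cong (λ h → ballot h h) (⌊double/2⌋ k))

catalanHalf-suc-double : ∀ k → catalanHalf (suc (double k)) ≡ 0
catalanHalf-suc-double k rewrite even-double k = refl

odd-suc-double : ∀ k → not (even (suc (double k))) ≡ true
odd-suc-double k = cong (not ∘ not) (even-double k)

-- The hypothesis excludes n = 0, where n ∸ 1 truncates to 0 and catalanHalf 0 = 1.
upDown-count : ∀ n → 1 ≤ n → (if not (even n) then avoiderCount true n else 0) ≡ catalanHalf (n ∸ 1)
upDown-count n 1≤n with even-or-odd n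
... | inj₁ (zero  , refl) = contradiction 1≤n λ ()
... | inj₁ (suc k , refl) = trans (if-false (cong not (even-double (suc k)))) (sym (catalanHalf-suc-double k))
... | inj₂ (k     , refl) = trans (if-true (odd-suc-double k))
  (trans (cong (λ h → ballot h h) (⌊suc-double/2⌋ k)) (sym (catalanHalf-double k)))

upUp-count : ∀ n → (if even n then avoiderCount true n else 0) ≡ catalanHalf n
upUp-count n with even-or-odd n
... | inj₁ (k , refl) = trans (if-true (even-double k))
  (trans (cong (λ h → ballot h h) (⌊double/2⌋ k)) (sym (catalanHalf-double k)))
... | inj₂ (k , refl) = trans (if-false (cong not (even-double k))) (sym (catalanHalf-suc-double k))

downUp-count : ∀ n → (if not (even n) then avoiderCount false n else 0) ≡ catalanHalf (n + 1)
downUp-count n rewrite +-comm n 1 with even-or-odd n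
... | inj₁ (k , refl) = trans (if-false (cong not (even-double k))) (sym (catalanHalf-suc-double k))
... | inj₂ (k , refl) = trans (if-true (odd-suc-double k))
  (trans (cong (λ h → ballot h h) (⌊double/2⌋ (suc k))) (sym (catalanHalf-double (suc k))))

downDown-count : ∀ n → (if even n then avoiderCount false n else 0) ≡ catalanHalf n
downDown-count n with even-or-odd n
... | inj₁ (k , refl) = trans (if-true (even-double k))
  (trans (cong (λ h → ballot h h) (⌊suc-double/2⌋ k)) (sym (catalanHalf-double k)))
... | inj₂ (k , refl) = trans (if-false (cong not (even-double k))) (sym (catalanHalf-suc-double k))

theorem2p2 : ((n : ℕ) → HasCount (Avoiders n alternating) (catalan (n / 2)))
    × ((n : ℕ) → 3 ≤ n →
    HasCount (Avoiders n upDown) (catalanHalf (n ∸ 1))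
    × HasCount (Avoiders n upUp) (catalanHalf n)
    × HasCount (Avoiders n downUp) (catalanHalf (n + 1))
    × HasCount (Avoiders n downDown) (catalanHalf n))
theorem2p2 =
  (λ n → ↔-count (alternating-↔ n) (sym (catalan≡ballot⌊n/2⌋ n))) ,
  λ n 3≤n →
    ↔-count (alternatingClass-↔ n true  (not (even n))) (upDown-count n (≤-trans (s≤s z≤n) 3≤n)) ,
    ↔-count (alternatingClass-↔ n true  (even n))       (upUp-count n) ,
    ↔-count (alternatingClass-↔ n false (not (even n))) (downUp-count n) ,
    ↔-count (alternatingClass-↔ n false (even n))       (downDown-count n)
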